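{- Let $(G,\sigma)$ be a critically $k$-frustrated signed graph, let $k_1,\dots,k_t$ be positive integers with $k=\sum_{i=1}^t k_i$, and suppose $(G_1,\sigma),\dots,(G_t,\sigma)$ are pairwise edge-disjoint signed subgraphs of $(G,\sigma)$ such that $(G_i,\sigma)$ is $k_i$-frustrated for each $i$. Then $E(G)=\bigcup_{i=1}^t E(G_i)$ and $(G,\sigma)$ is $(k_1,\dots,k_t)$-decomposable (with parts $E(G_1),\dots,E(G_t)$). In particular, a critically $k$-frustrated signed graph containing $k$ edge-disjoint negative cycles is the union of these negative cycles.
   Context: A signed graph $(G,\sigma)$ is a finite graph $G$ (loops and multiple edges allowed) with a signature $\sigma:E(G)\to\{+,-\}$; for a subgraph $H$, $(H,\sigma)$ denotes $H$ with the restriction of $\sigma$. A cycle is negative if it contains an odd number of negative edges. Switching at a vertex $v$ multiplies the signs of all edges incident with $v$ by $-$. The frustration index $\ell(G,\sigma)$ is the minimum number of negative edges over all signatures obtained from $\sigma$ by sequences of switchings; $(G,\sigma)$ is $k$-frustrated if $\ell(G,\sigma)=k$, and critically $k$-frustrated if moreover $\ell(G-e,\sigma)=k-1$ for every edge $e$. A critically $k$-frustrated $(G,\sigma)$ is $(k_1,\dots,k_t)$-decomposable ($k_i$ positive integers summing to $k$) if $E(G)$ can be partitioned into $E_1,\dots,E_t$ such that each $(G[E_i],\sigma)$ is critically $k_i$-frustrated. -}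

module Defs where

open import Data.Bool using (Bool; true; false; _xor_; _∧_; not)
open import Data.Nat using (ℕ; zero; suc; _+_; _≤_; _<_; _%_; _≟_)
import Data.Nat.Properties as ℕP
open import Data.Fin using (Fin; zero; suc; toℕ; fromℕ<)
import Data.Fin as F
open import Data.Fin.Properties using (any?)
open import Data.Product using (Σ; ∃; _×_; _,_)
open import Data.Sum using (_⊎_)
open import Relation.Binary.PropositionalEquality using (_≡_; _≢_)
open import Relation.Nullary using (¬_; yes; no; does)
open import Function.Definitions using (Injective)

-- A finite graph (loops and multiple edges allowed):
-- vertices Fin n, edges Fin m, each edge with its (unordered) pair of ends.
record Graph : Set where
  field
    n    : ℕ
    m    : ℕ
    ends : Fin m → Fin n × Fin n
open Graph public

-- A signature: true = negative edge, false = positive edge.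
Signature : Graph → Set
Signature G = Fin (m G) → Bool

-- An edge set (of a spanning subgraph) of G, as a characteristic function.
EdgeSet : Graph → Set
EdgeSet G = Fin (m G) → Bool

_∈E_ : {G : Graph} → Fin (m G) → EdgeSet G → Set
_∈E_ e S = S e ≡ true

allEdges : (G : Graph) → EdgeSet G
allEdges G _ = true

_─_ : {G : Graph} → EdgeSet G → Fin (m G) → EdgeSet G
(S ─ e) f with does (e F.≟ f)
... | true  = false
... | false = S f

bit : Bool → ℕ
bit true  = 1
bit false = 0

count : {k : ℕ} → (Fin k → Bool) → ℕ
count {zero}  P = 0
count {suc k} P = bit (P zero) + count (λ i → P (suc i))

-- A switching is given by the set X of switched vertices (true = switched).
-- Switching at X multiplies the sign of an edge uv by (-)^{[u∈X]+[v∈X]};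
-- any sequence of switchings amounts to switching at such a set X.
Switching : Graph → Set
Switching G = Fin (n G) → Bool

switch : (G : Graph) → Signature G → Switching G → Signature G
switch G σ X e with ends G e
... | (u , v) = σ e xor (X u xor X v)

negCount : (G : Graph) → Signature G → EdgeSet G → Switching G → ℕ
negCount G σ S X = count (λ e → S e ∧ switch G σ X e)

Frustrated : (G : Graph) → Signature G → EdgeSet G → ℕ → Set
Frustrated G σ S k =
  (∃ λ (X : Switching G) → negCount G σ S X ≡ k) × (∀ (X : Switching G) → k ≤ negCount G σ S X)

CriticallyFrustrated : (G : Graph) → Signature G → EdgeSet G → ℕ → Set
CriticallyFrustrated G σ S k =
  Frustrated G σ S k ×
  (∀ (e : Fin (m G)) → _∈E_ {G} e S → Σ ℕ λ j → (suc j ≡ k) × Frustrated G σ (_─_ {G} S e) j)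

sumF : {t : ℕ} → (Fin t → ℕ) → ℕ
sumF {zero}  f = 0
sumF {suc t} f = f zero + sumF (λ i → f (suc i))

PairwiseDisjoint : (G : Graph) {t : ℕ} → (Fin t → EdgeSet G) → Set
PairwiseDisjoint G {t} Es = ∀ (i j : Fin t) → i ≢ j → ∀ (e : Fin (m G)) → _∈E_ {G} e (Es i) → ¬ (_∈E_ {G} e (Es j))

Covers : (G : Graph) {t : ℕ} → (Fin t → EdgeSet G) → Set
Covers G {t} Es = ∀ (e : Fin (m G)) → ∃ λ (i : Fin t) → _∈E_ {G} e (Es i)

IsDecomposition : (G : Graph) → Signature G → {t : ℕ} →
                  (Fin t → ℕ) → (Fin t → EdgeSet G) → Set
IsDecomposition G σ {t} ks Es =
  Covers G Es × PairwiseDisjoint G Es × (∀ (i : Fin t) → CriticallyFrustrated G σ (Es i) (ks i))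

Decomposable : (G : Graph) → Signature G → {t : ℕ} → (Fin t → ℕ) → Set
Decomposable G σ {t} ks = ∃ λ (Es : Fin t → EdgeSet G) → IsDecomposition G σ ks Es

next : {L : ℕ} → Fin (suc L) → Fin (suc L)
next {L} i with toℕ i ℕP.<? L
... | yes p = fromℕ< (Data.Nat.s≤s p)
... | no  _ = zero

-- A cycle of length suc L in G: distinct vertices v₀,…,v_L and distinct
-- edges e₀,…,e_L with eᵢ joining vᵢ and v_{i+1 mod (L+1)}.
-- (Length 1 = a loop, length 2 = a pair of parallel edges.)
record Cycle (G : Graph) : Set where
  field
    L     : ℕ
    verts : Fin (suc L) → Fin (n G)
    edges : Fin (suc L) → Fin (m G)
    verts-inj : Injective _≡_ _≡_ verts
    edges-inj : Injective _≡_ _≡_ edges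
    joins : ∀ i → (ends G (edges i) ≡ (verts i , verts (next i)))
                ⊎ (ends G (edges i) ≡ (verts (next i) , verts i))
open Cycle public

cycleEdges : (G : Graph) → Cycle G → EdgeSet G
cycleEdges G C e = does (any? (λ i → edges C i F.≟ e))

NegativeCycle : (G : Graph) → Signature G → Cycle G → Set
NegativeCycle G σ C = count (λ i → σ (edges C i)) % 2 ≡ 1

-- Deleting an edge e from a critically k-frustrated (G, σ) leaves a switching X with only
-- k - 1 negative edges.  Counts of negative edges in pairwise edge-disjoint subgraphs add up
-- to at most the total, while Gᵢ has at least kᵢ under every switching; so if no Gᵢ
-- contained e, the Gᵢ would force k negative edges inside G - e.  If e ∈ Gᵢ, the other Gⱼ
-- still carry at least kⱼ negative edges under X, leaving at most kᵢ - 1 for Gᵢ - e, so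
-- each Gᵢ is critical.  A negative cycle is 1-frustrated since switching preserves the
-- parity of its negative edges.
module Submission where

open import Defs
open import Data.Nat using (ℕ; _<_; _≤_)
open import Data.Fin using (Fin)
open import Data.Product using (_×_; ∃)
open import Relation.Binary.PropositionalEquality using (_≡_)

open import Data.Bool using (Bool; true; false; _xor_; _∧_; not; _≟_)
open import Data.Bool.Properties using (xor-assoc; xor-comm; xor-same; xor-identityʳ)
open import Data.Empty using (⊥-elim)
open import Data.Fin using (zero; suc; toℕ; fromℕ; inject₁)
import Data.Fin as F
open import Data.Fin.Properties using (any?; suc-injective; toℕ-inject₁; toℕ<n; toℕ-fromℕ; fromℕ<-cong; fromℕ<-toℕ)
open import Data.Nat using (zero; suc; pred; _+_; _%_; z≤n; s≤s; s≤s⁻¹; >-nonZero)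
import Data.Nat.Properties as ℕP
open import Algebra.Properties.CommutativeSemigroup ℕP.+-commutativeSemigroup using (interchange)
open import Data.Nat.DivMod using (%-distribˡ-+)
open import Data.Product using (Σ; _,_; proj₁; proj₂)
open import Data.Sum using (inj₁; inj₂)
open import Function using (_∘_)
open import Relation.Nullary using (¬_; yes; no)
open import Relation.Nullary.Decidable using (dec-true; dec-false)
open import Relation.Binary.PropositionalEquality using (refl; sym; trans; cong; cong₂; subst; _≢_; ≢-sym; module ≡-Reasoning)

∧-elimˡ : ∀ {a b} → a ∧ b ≡ true → a ≡ true
∧-elimˡ {true} _ = refl

∧-elimʳ : ∀ {a b} → a ∧ b ≡ true → b ≡ true
∧-elimʳ {true} b≡true = b≡true

∧-intro : ∀ {a b} → a ≡ true → b ≡ true → a ∧ b ≡ true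
∧-intro refl refl = refl

not-intro : ∀ {a} → ¬ a ≡ true → not a ≡ true
not-intro {false} _ = refl
not-intro {true} a≢true = ⊥-elim (a≢true refl)

xor≡false⇒≡ : ∀ {a b} → a xor b ≡ false → a ≡ b
xor≡false⇒≡ {true} {true} _ = refl
xor≡false⇒≡ {false} {false} _ = refl

xor-cancel-middle : ∀ x y z → (x xor y) xor (y xor z) ≡ x xor z
xor-cancel-middle x y z = begin
  (x xor y) xor (y xor z)  ≡⟨ xor-assoc x y (y xor z) ⟩
  x xor (y xor (y xor z))  ≡⟨ cong (x xor_) (sym (xor-assoc y y z)) ⟩
  x xor ((y xor y) xor z)  ≡⟨ cong (λ w → x xor (w xor z)) (xor-same y) ⟩
  x xor z                  ∎
  where open ≡-Reasoning

bit-split : ∀ a b → bit a ≡ bit (a ∧ b) + bit (a ∧ not b)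
bit-split true true = refl
bit-split true false = refl
bit-split false _ = refl

bit-mono : ∀ {a b} → (a ≡ true → b ≡ true) → bit a ≤ bit b
bit-mono {false} _ = z≤n
bit-mono {true} a⇒b rewrite a⇒b refl = ℕP.≤-refl

bit≤1 : ∀ a → bit a ≤ 1
bit≤1 true = ℕP.≤-refl
bit≤1 false = z≤n

count-mono : ∀ {k} (P Q : Fin k → Bool) → (∀ i → P i ≡ true → Q i ≡ true) → count P ≤ count Q
count-mono {zero} P Q P⊆Q = z≤n
count-mono {suc k} P Q P⊆Q =
  ℕP.+-mono-≤ (bit-mono (P⊆Q zero)) (count-mono (λ i → P (suc i)) (λ i → Q (suc i)) (λ i → P⊆Q (suc i)))

count-mono-except : ∀ {k} (e : Fin k) (P Q : Fin k → Bool) →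
                    (∀ i → i ≢ e → P i ≡ true → Q i ≡ true) → count P ≤ suc (count Q)
count-mono-except zero P Q P⊆Q = ℕP.+-mono-≤ (bit≤1 (P zero))
  (ℕP.≤-trans (count-mono _ _ (λ i → P⊆Q (suc i) λ ())) (ℕP.m≤n+m _ (bit (Q zero))))
count-mono-except (suc e) P Q P⊆Q = begin
  bit (P zero) + count (λ i → P (suc i))        ≤⟨ ℕP.+-mono-≤ (bit-mono (P⊆Q zero λ ())) tail ⟩
  bit (Q zero) + suc (count (λ i → Q (suc i)))  ≡⟨ ℕP.+-suc (bit (Q zero)) _ ⟩
  suc (count Q)                                 ∎
  where
  open ℕP.≤-Reasoning
  tail : count (λ i → P (suc i)) ≤ suc (count (λ i → Q (suc i)))
  tail = count-mono-except e _ _ (λ i i≢e → P⊆Q (suc i) (i≢e ∘ suc-injective))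

count≡0⇒≡false : ∀ {k} (P : Fin k → Bool) → count P ≡ 0 → ∀ i → P i ≡ false
count≡0⇒≡false P count≡0 zero with P zero
... | false = refl
count≡0⇒≡false P count≡0 (suc i) with P zero
... | false = count≡0⇒≡false (λ i → P (suc i)) count≡0 i

count-split : ∀ {k} (P Q : Fin k → Bool) →
              count P ≡ count (λ i → P i ∧ Q i) + count (λ i → P i ∧ not (Q i))
count-split {zero} P Q = refl
count-split {suc k} P Q = begin
  bit (P zero) + count P′
    ≡⟨ cong₂ _+_ (bit-split (P zero) (Q zero)) (count-split P′ Q′) ⟩
  (bit (P zero ∧ Q zero) + bit (P zero ∧ not (Q zero))) + (count (λ i → P′ i ∧ Q′ i) + count (λ i → P′ i ∧ not (Q′ i)))
    ≡⟨ interchange (bit (P zero ∧ Q zero)) _ _ _ ⟩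
  count (λ i → P i ∧ Q i) + count (λ i → P i ∧ not (Q i)) ∎
  where
  open ≡-Reasoning
  P′ Q′ : Fin k → Bool
  P′ i = P (suc i)
  Q′ i = Q (suc i)

sumF-count-disjoint : ∀ {t k} (Qs : Fin t → Fin k → Bool) (P : Fin k → Bool) →
                      (∀ i j → i ≢ j → ∀ e → Qs i e ≡ true → ¬ Qs j e ≡ true) →
                      (∀ i e → Qs i e ≡ true → P e ≡ true) →
                      sumF (λ i → count (Qs i)) ≤ count P
sumF-count-disjoint {zero} Qs P disjoint Qs⊆P = z≤n
sumF-count-disjoint {suc t} Qs P disjoint Qs⊆P = begin
  count (Qs zero) + sumF (λ i → count (Qs (suc i)))
    ≤⟨ ℕP.+-mono-≤ (count-mono _ _ (λ e q → ∧-intro (Qs⊆P zero e q) q)) rest ⟩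
  count (λ e → P e ∧ Qs zero e) + count (λ e → P e ∧ not (Qs zero e))
    ≡⟨ count-split P (Qs zero) ⟨
  count P ∎
  where
  open ℕP.≤-Reasoning
  rest : sumF (λ i → count (Qs (suc i))) ≤ count (λ e → P e ∧ not (Qs zero e))
  rest = sumF-count-disjoint (λ i → Qs (suc i)) (λ e → P e ∧ not (Qs zero e))
           (λ i j i≢j → disjoint (suc i) (suc j) (i≢j ∘ suc-injective))
           (λ i e q → ∧-intro (Qs⊆P (suc i) e q) (not-intro (disjoint (suc i) zero (λ ()) e q)))

sumF-mono : ∀ {t} (f g : Fin t → ℕ) → (∀ i → f i ≤ g i) → sumF f ≤ sumF g
sumF-mono {zero} f g f≤g = z≤n
sumF-mono {suc t} f g f≤g = ℕP.+-mono-≤ (f≤g zero) (sumF-mono _ _ (λ i → f≤g (suc i)))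

sumF-exchange : ∀ {t} (i : Fin t) (f g : Fin t → ℕ) →
                (∀ j → j ≢ i → g j ≤ f j) → sumF g + f i ≤ sumF f + g i
sumF-exchange zero f g g≤f = begin
  (g zero + Σg) + f zero  ≡⟨ ℕP.+-comm (g zero + Σg) (f zero) ⟩
  f zero + (g zero + Σg)  ≤⟨ ℕP.+-monoʳ-≤ (f zero) (ℕP.+-monoʳ-≤ (g zero) Σg≤Σf) ⟩
  f zero + (g zero + Σf)  ≡⟨ cong (f zero +_) (ℕP.+-comm (g zero) Σf) ⟩
  f zero + (Σf + g zero)  ≡⟨ ℕP.+-assoc (f zero) Σf (g zero) ⟨
  (f zero + Σf) + g zero  ∎
  where
  open ℕP.≤-Reasoning
  Σf Σg : ℕ
  Σf = sumF (λ j → f (suc j))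
  Σg = sumF (λ j → g (suc j))
  Σg≤Σf : Σg ≤ Σf
  Σg≤Σf = sumF-mono _ _ (λ j → g≤f (suc j) λ ())
sumF-exchange (suc i) f g g≤f = begin
  (g zero + Σg) + f (suc i)  ≡⟨ ℕP.+-assoc (g zero) Σg (f (suc i)) ⟩
  g zero + (Σg + f (suc i))  ≤⟨ ℕP.+-mono-≤ (g≤f zero λ ()) rest ⟩
  f zero + (Σf + g (suc i))  ≡⟨ ℕP.+-assoc (f zero) Σf (g (suc i)) ⟨
  (f zero + Σf) + g (suc i)  ∎
  where
  open ℕP.≤-Reasoning
  Σf Σg : ℕ
  Σf = sumF (λ j → f (suc j))
  Σg = sumF (λ j → g (suc j))
  rest : Σg + f (suc i) ≤ Σf + g (suc i)
  rest = sumF-exchange i (λ j → f (suc j)) (λ j → g (suc j)) (λ j j≢i → g≤f (suc j) (j≢i ∘ suc-injective))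

sumF-ones : ∀ k → sumF {k} (λ _ → 1) ≡ k
sumF-ones zero = refl
sumF-ones (suc k) = cong suc (sumF-ones k)

parity : ∀ {k} → (Fin k → Bool) → Bool
parity {zero} P = false
parity {suc k} P = P zero xor parity (λ i → P (suc i))

parity-cong : ∀ {k} (P Q : Fin k → Bool) → (∀ i → P i ≡ Q i) → parity P ≡ parity Q
parity-cong {zero} P Q P≡Q = refl
parity-cong {suc k} P Q P≡Q =
  cong₂ _xor_ (P≡Q zero) (parity-cong (λ i → P (suc i)) (λ i → Q (suc i)) (λ i → P≡Q (suc i)))

count%2≡parity : ∀ {k} (P : Fin k → Bool) → count P % 2 ≡ bit (parity P)
count%2≡parity {zero} P = refl
count%2≡parity {suc k} P = begin
  (bit (P zero) + count P′) % 2              ≡⟨ %-distribˡ-+ (bit (P zero)) (count P′) 2 ⟩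
  (bit (P zero) % 2 + count P′ % 2) % 2      ≡⟨ cong (λ r → (bit (P zero) % 2 + r) % 2) (count%2≡parity P′) ⟩
  (bit (P zero) % 2 + bit (parity P′)) % 2   ≡⟨ bit-xor (P zero) (parity P′) ⟩
  bit (P zero xor parity P′)                 ∎
  where
  open ≡-Reasoning
  P′ : Fin k → Bool
  P′ i = P (suc i)
  bit-xor : ∀ a b → (bit a % 2 + bit b) % 2 ≡ bit (a xor b)
  bit-xor true true = refl
  bit-xor true false = refl
  bit-xor false true = refl
  bit-xor false false = refl

parity-snoc : ∀ L (P : Fin (suc L) → Bool) → parity P ≡ parity (λ j → P (inject₁ j)) xor P (fromℕ L)
parity-snoc zero P = xor-identityʳ (P zero)
parity-snoc (suc L) P = begin
  P zero xor parity P′                                          ≡⟨ cong (P zero xor_) (parity-snoc L P′) ⟩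
  P zero xor (parity (λ j → P′ (inject₁ j)) xor P′ (fromℕ L))   ≡⟨ xor-assoc (P zero) _ _ ⟨
  (P zero xor parity (λ j → P′ (inject₁ j))) xor P′ (fromℕ L)   ∎
  where
  open ≡-Reasoning
  P′ : Fin (suc L) → Bool
  P′ i = P (suc i)

parity-telescope : ∀ L (a : Fin (suc L) → Bool) →
                   parity (λ j → a (inject₁ j) xor a (suc j)) ≡ a zero xor a (fromℕ L)
parity-telescope zero a = sym (xor-same (a zero))
parity-telescope (suc L) a = begin
  (a zero xor a (suc zero)) xor parity (λ j → a (suc (inject₁ j)) xor a (suc (suc j)))
    ≡⟨ cong ((a zero xor a (suc zero)) xor_) (parity-telescope L (λ i → a (suc i))) ⟩
  (a zero xor a (suc zero)) xor (a (suc zero) xor a (suc (fromℕ L)))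
    ≡⟨ xor-cancel-middle (a zero) (a (suc zero)) (a (suc (fromℕ L))) ⟩
  a zero xor a (suc (fromℕ L)) ∎
  where open ≡-Reasoning

next-inject₁ : ∀ {L} (j : Fin L) → next (inject₁ j) ≡ suc j
next-inject₁ {L} j with toℕ (inject₁ j) ℕP.<? L
... | yes j<L = trans (fromℕ<-cong _ _ (cong suc (toℕ-inject₁ j)) (s≤s j<L) (s≤s (toℕ<n j)))
                      (fromℕ<-toℕ (suc j) (s≤s (toℕ<n j)))
... | no j≮L = ⊥-elim (j≮L (subst (_< L) (sym (toℕ-inject₁ j)) (toℕ<n j)))

next-fromℕ : ∀ L → next (fromℕ L) ≡ zero
next-fromℕ L with toℕ (fromℕ L) ℕP.<? L
... | yes L<L = ⊥-elim (ℕP.n≮n L (subst (_< L) (toℕ-fromℕ L) L<L))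
... | no _ = refl

parity-around-cycle : ∀ L (a : Fin (suc L) → Bool) → parity (λ i → a i xor a (next i)) ≡ false
parity-around-cycle L a = begin
  parity (λ i → a i xor a (next i))
    ≡⟨ parity-snoc L (λ i → a i xor a (next i)) ⟩
  parity (λ j → a (inject₁ j) xor a (next (inject₁ j))) xor (a (fromℕ L) xor a (next (fromℕ L)))
    ≡⟨ cong₂ _xor_ (parity-cong _ _ (λ j → cong (λ i → a (inject₁ j) xor a i) (next-inject₁ j)))
                   (cong (λ i → a (fromℕ L) xor a i) (next-fromℕ L)) ⟩
  parity (λ j → a (inject₁ j) xor a (suc j)) xor (a (fromℕ L) xor a zero)
    ≡⟨ cong (_xor (a (fromℕ L) xor a zero)) (parity-telescope L a) ⟩
  (a zero xor a (fromℕ L)) xor (a (fromℕ L) xor a zero)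
    ≡⟨ xor-cancel-middle (a zero) (a (fromℕ L)) (a zero) ⟩
  a zero xor a zero
    ≡⟨ xor-same (a zero) ⟩
  false ∎
  where open ≡-Reasoning

module EdgeSetProperties (G : Graph) where

  _∈_ : Fin (m G) → EdgeSet G → Set
  e ∈ S = _∈E_ {G} e S

  _∖_ : EdgeSet G → Fin (m G) → EdgeSet G
  S ∖ e = _─_ {G} S e

  _⊆_ : EdgeSet G → EdgeSet G → Set
  S ⊆ T = ∀ e → e ∈ S → e ∈ T

  ∖-≢ : ∀ S e {f} → f ≢ e → (S ∖ e) f ≡ S f
  ∖-≢ S e {f} f≢e rewrite dec-false (e F.≟ f) (≢-sym f≢e) = refl

  ∖-self : ∀ S e → (S ∖ e) e ≡ false
  ∖-self S e rewrite dec-true (e F.≟ e) refl = refl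

  ∈∖⇒≢ : ∀ S e {f} → f ∈ (S ∖ e) → f ≢ e
  ∈∖⇒≢ S e e∈S∖e refl with trans (sym (∖-self S e)) e∈S∖e
  ... | ()

  ∖-⊆ : ∀ S e → (S ∖ e) ⊆ S
  ∖-⊆ S e f f∈S∖e = trans (sym (∖-≢ S e (∈∖⇒≢ S e f∈S∖e))) f∈S∖e

  ∖-mono : ∀ {S T} e → S ⊆ T → (S ∖ e) ⊆ (T ∖ e)
  ∖-mono {S} {T} e S⊆T f f∈S∖e = trans (∖-≢ T e (∈∖⇒≢ S e f∈S∖e)) (S⊆T f (∖-⊆ S e f f∈S∖e))

  ⊆-∖ : ∀ {S T e} → S ⊆ T → ¬ e ∈ S → S ⊆ (T ∖ e)
  ⊆-∖ {S} {T} {e} S⊆T e∉S f f∈S = trans (∖-≢ T e f≢e) (S⊆T f f∈S)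
    where
    f≢e : f ≢ e
    f≢e refl = e∉S f∈S

  pairwiseDisjoint-⊆ : ∀ {t} {Ss Ts : Fin t → EdgeSet G} →
                       (∀ i → Ts i ⊆ Ss i) → PairwiseDisjoint G Ss → PairwiseDisjoint G Ts
  pairwiseDisjoint-⊆ Ts⊆Ss disjoint i j i≢j e e∈Tᵢ e∈Tⱼ =
    disjoint i j i≢j e (Ts⊆Ss i e e∈Tᵢ) (Ts⊆Ss j e e∈Tⱼ)

module Frustration (G : Graph) (σ : Signature G) where
  open EdgeSetProperties G

  FrustrationAtLeast : EdgeSet G → ℕ → Set
  FrustrationAtLeast S k = ∀ X → k ≤ negCount G σ S X

  negCount-mono : ∀ {S T} → S ⊆ T → ∀ X → negCount G σ S X ≤ negCount G σ T X
  negCount-mono S⊆T X = count-mono _ _ (λ e p → ∧-intro (S⊆T e (∧-elimˡ p)) (∧-elimʳ p))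

  negCount-∖ : ∀ S e X → negCount G σ S X ≤ suc (negCount G σ (S ∖ e) X)
  negCount-∖ S e X = count-mono-except e _ _ (λ f f≢e p → ∧-intro (trans (∖-≢ S e f≢e) (∧-elimˡ p)) (∧-elimʳ p))

  sumF-negCount-disjoint : ∀ {t} {Ss : Fin t → EdgeSet G} {T} → PairwiseDisjoint G Ss → (∀ i → Ss i ⊆ T) →
                           ∀ X → sumF (λ i → negCount G σ (Ss i) X) ≤ negCount G σ T X
  sumF-negCount-disjoint disjoint Ss⊆T X = sumF-count-disjoint _ _
    (λ i j i≢j e p q → disjoint i j i≢j e (∧-elimˡ p) (∧-elimˡ q))
    (λ i e p → ∧-intro (Ss⊆T i e (∧-elimˡ p)) (∧-elimʳ p))

  covers : ∀ {k t} (ks : Fin t → ℕ) (Gs : Fin t → EdgeSet G) →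
           CriticallyFrustrated G σ (allEdges G) k → sumF ks ≡ k → PairwiseDisjoint G Gs →
           (∀ i → FrustrationAtLeast (Gs i) (ks i)) → Covers G Gs
  covers ks Gs (_ , critical) Σks≡k disjoint atLeast e with any? (λ i → Gs i e ≟ true)
  ... | yes e∈Gs = e∈Gs
  ... | no e∉Gs with critical e refl
  ... | j , 1+j≡k , (X , X-optimal) , _ = ⊥-elim (ℕP.<-irrefl refl (begin-strict
    j                                   <⟨ ℕP.n<1+n j ⟩
    suc j                               ≡⟨ trans 1+j≡k (sym Σks≡k) ⟩
    sumF ks                             ≤⟨ sumF-mono _ _ (λ i → atLeast i X) ⟩
    sumF (λ i → negCount G σ (Gs i) X)  ≤⟨ sumF-negCount-disjoint disjoint Gs⊆G∖e X ⟩
    negCount G σ (allEdges G ∖ e) X     ≡⟨ X-optimal ⟩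
    j                                   ∎))
    where
    open ℕP.≤-Reasoning
    Gs⊆G∖e : ∀ i → Gs i ⊆ (allEdges G ∖ e)
    Gs⊆G∖e i = ⊆-∖ (λ _ _ → refl) (λ e∈Gsᵢ → e∉Gs (i , e∈Gsᵢ))

  part-∖-negCount< : ∀ {k t} (ks : Fin t → ℕ) (Gs : Fin t → EdgeSet G) →
                     CriticallyFrustrated G σ (allEdges G) k → sumF ks ≡ k → PairwiseDisjoint G Gs →
                     (∀ i → FrustrationAtLeast (Gs i) (ks i)) →
                     ∀ {i e} → e ∈ Gs i → ∃ λ X → negCount G σ (Gs i ∖ e) X < ks i
  part-∖-negCount< ks Gs (_ , critical) Σks≡k disjoint atLeast {i} {e} e∈Gsᵢ with critical e refl
  ... | j , 1+j≡k , (X , X-optimal) , _ = X , ℕP.+-cancelˡ-≤ j _ _ (begin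
    j + suc (ν i)    ≡⟨ ℕP.+-suc j (ν i) ⟩
    suc j + ν i      ≡⟨ cong (_+ ν i) (trans 1+j≡k (sym Σks≡k)) ⟩
    sumF ks + ν i    ≤⟨ sumF-exchange i ν ks others ⟩
    sumF ν + ks i    ≤⟨ ℕP.+-monoˡ-≤ (ks i) (ℕP.≤-trans Σν≤ (ℕP.≤-reflexive X-optimal)) ⟩
    j + ks i         ∎)
    where
    open ℕP.≤-Reasoning
    ν : Fin _ → ℕ
    ν j = negCount G σ (Gs j ∖ e) X
    Σν≤ : sumF ν ≤ negCount G σ (allEdges G ∖ e) X
    Σν≤ = sumF-negCount-disjoint (pairwiseDisjoint-⊆ (λ j → ∖-⊆ (Gs j) e) disjoint)
                                 (λ j → ∖-mono e (λ _ _ → refl)) X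
    others : ∀ j → j ≢ i → ks j ≤ ν j
    others j j≢i = ℕP.≤-trans (atLeast j X)
      (negCount-mono (⊆-∖ (λ _ f∈ → f∈) (λ e∈Gsⱼ → disjoint i j (≢-sym j≢i) e e∈Gsᵢ e∈Gsⱼ)) X)

  frustrated-∖ : ∀ S e {j k} → suc j ≡ k → FrustrationAtLeast S k →
                 (∃ λ X → negCount G σ (S ∖ e) X < k) → Frustrated G σ (S ∖ e) j
  frustrated-∖ S e refl atLeast (X , X<k) = (X , ℕP.≤-antisym (s≤s⁻¹ X<k) (lower X)) , lower
    where
    lower : FrustrationAtLeast (S ∖ e) _
    lower X = s≤s⁻¹ (ℕP.≤-trans (atLeast X) (negCount-∖ S e X))

  decomposition : ∀ {k t} (ks : Fin t → ℕ) (Gs : Fin t → EdgeSet G) →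
                  CriticallyFrustrated G σ (allEdges G) k → (∀ i → 0 < ks i) → sumF ks ≡ k →
                  PairwiseDisjoint G Gs → (∀ i → Frustrated G σ (Gs i) (ks i)) →
                  IsDecomposition G σ ks Gs
  decomposition ks Gs critical positive Σks≡k disjoint frustrated =
    covers ks Gs critical Σks≡k disjoint atLeast , disjoint , λ i → frustrated i , removal i
    where
    atLeast : ∀ i → FrustrationAtLeast (Gs i) (ks i)
    atLeast i = proj₂ (frustrated i)
    removal : ∀ i e → e ∈ Gs i → Σ ℕ λ j → (suc j ≡ ks i) × Frustrated G σ (Gs i ∖ e) j
    removal i e e∈Gsᵢ = pred (ks i) , 1+pred≡ ,
      frustrated-∖ (Gs i) e 1+pred≡ (atLeast i) (part-∖-negCount< ks Gs critical Σks≡k disjoint atLeast e∈Gsᵢ)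
      where
      1+pred≡ : suc (pred (ks i)) ≡ ks i
      1+pred≡ = ℕP.suc-pred (ks i) {{>-nonZero (positive i)}}

  switch-ends : ∀ X e {u v} → ends G e ≡ (u , v) → switch G σ X e ≡ σ e xor (X u xor X v)
  switch-ends X e ends≡ with ends G e
  switch-ends X e refl | _ = refl

  negativeCycle-frustration : ∀ C → NegativeCycle G σ C → FrustrationAtLeast (cycleEdges G C) 1
  negativeCycle-frustration C negative X with negCount G σ (cycleEdges G C) X in none
  ... | suc _ = s≤s z≤n
  ... | zero = ⊥-elim (1≢0 (begin
    1                                  ≡⟨ negative ⟨
    count (σ ∘ edges C) % 2            ≡⟨ count%2≡parity (σ ∘ edges C) ⟩
    bit (parity (σ ∘ edges C))         ≡⟨ cong bit (parity-cong _ _ coboundary) ⟩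
    bit (parity (λ i → a i xor a (next i)))  ≡⟨ cong bit (parity-around-cycle (L C) a) ⟩
    0                                  ∎))
    where
    open ≡-Reasoning
    1≢0 : 1 ≢ 0
    1≢0 ()
    a : Fin (suc (L C)) → Bool
    a = X ∘ verts C
    unswitched : ∀ i → switch G σ X (edges C i) ≡ false
    unswitched i = subst (λ b → b ∧ switch G σ X (edges C i) ≡ false)
      (dec-true (any? (λ j → edges C j F.≟ edges C i)) (i , refl))
      (count≡0⇒≡false _ none (edges C i))
    coboundary : ∀ i → σ (edges C i) ≡ a i xor a (next i)
    coboundary i with joins C i
    ... | inj₁ forward = xor≡false⇒≡ (trans (sym (switch-ends X (edges C i) forward)) (unswitched i))
    ... | inj₂ backward =
      trans (xor≡false⇒≡ (trans (sym (switch-ends X (edges C i) backward)) (unswitched i)))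
            (xor-comm (a (next i)) (a i))

mainTheorem7 :
    ((G : Graph) (σ : Signature G) (k t : ℕ) (ks : Fin t → ℕ)
     (Gs : Fin t → EdgeSet G) →
     CriticallyFrustrated G σ (allEdges G) k →
     (∀ i → 0 < ks i) →
     sumF ks ≡ k →
     PairwiseDisjoint G Gs →
     (∀ i → Frustrated G σ (Gs i) (ks i)) →
     Covers G Gs × IsDecomposition G σ ks Gs)
    ×
    ((G : Graph) (σ : Signature G) (k : ℕ) (Cs : Fin k → Cycle G) →
     CriticallyFrustrated G σ (allEdges G) k →
     PairwiseDisjoint G (λ i → cycleEdges G (Cs i)) →
     (∀ i → NegativeCycle G σ (Cs i)) →
     Covers G (λ i → cycleEdges G (Cs i)))
mainTheorem7 =
  (λ G σ k t ks Gs critical positive Σks≡k disjoint frustrated →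
    let isDecomposition = Frustration.decomposition G σ ks Gs critical positive Σks≡k disjoint frustrated
    in proj₁ isDecomposition , isDecomposition) ,
  (λ G σ k Cs critical disjoint negative →
    Frustration.covers G σ (λ _ → 1) (λ i → cycleEdges G (Cs i)) critical (sumF-ones k) disjoint
      (λ i → Frustration.negativeCycle-frustration G σ (Cs i) (negative i)))
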